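{- Every formula $\varphi\in \mathrm{TeamLTL}^{l}(\vee_B)$ is logically equivalent to a formula $\varphi^*= \bigvee_{B,\,i\in I} \alpha_i$ in $\vee_B$-disjunctive normal form, where the $\alpha_i$ are LTL-formulae, $\lvert \alpha_i \rvert \leq \lvert \varphi \rvert$ and $\lvert I \rvert = 2^k$, where $k$ is the number of occurrences of $\vee_B$ in $\varphi$.
   Context: $\mathrm{TeamLTL}^l$ is LTL (negation normal form, operators $\wedge,\vee,\mathsf{X},\mathsf{G},\mathsf{U}$) under the lax set-based asynchronous team semantics $\models^l$ (split disjunction $T=T_1\cup T_2$; $\mathsf{G}$ and $\mathsf{U}$ quantify over functions $f\colon T\to\mathcal P(\mathbb N)\setminus\{\emptyset\}$ assigning sets of time points to each trace). $\vee_B$ denotes the Boolean disjunction ($T\models^l\varphi\vee_B\psi$ iff $T\models^l\varphi$ or $T\models^l\psi$), and $\bigvee_{B,i\in I}$ its iterated form. A formula is in $\vee_B$-disjunctive normal form if it is a Boolean disjunction of LTL-formulae. -}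

module Defs where

open import Level using (Level; 0ℓ) renaming (suc to lsuc)
open import Data.Bool using (Bool; true; false)
open import Data.Nat using (ℕ; zero; suc; _+_; _<_; _≤_)
open import Data.Product using (Σ; ∃; _×_; _,_)
open import Data.Sum using (_⊎_)
open import Data.Fin using (Fin)
open import Data.Vec using (Vec; lookup)
open import Relation.Binary.PropositionalEquality using (_≡_)

infixr 6 _∧_
infixr 5 _∨_ _∨B_
infixr 7 _U_

data Form (AP : Set) : Set where
  pos  : AP → Form AP
  neg  : AP → Form AP
  _∧_  : Form AP → Form AP → Form AP
  _∨_  : Form AP → Form AP → Form AP       -- split (team) disjunction
  X    : Form AP → Form AP
  G    : Form AP → Form AP
  _U_  : Form AP → Form AP → Form AP
  _∨B_ : Form AP → Form AP → Form AP

data IsLTL {AP : Set} : Form AP → Set where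
  pos : ∀ p → IsLTL (pos p)
  neg : ∀ p → IsLTL (neg p)
  _∧_ : ∀ {φ ψ} → IsLTL φ → IsLTL ψ → IsLTL (φ ∧ ψ)
  _∨_ : ∀ {φ ψ} → IsLTL φ → IsLTL ψ → IsLTL (φ ∨ ψ)
  X   : ∀ {φ} → IsLTL φ → IsLTL (X φ)
  G   : ∀ {φ} → IsLTL φ → IsLTL (G φ)
  _U_ : ∀ {φ ψ} → IsLTL φ → IsLTL ψ → IsLTL (φ U ψ)

size : ∀ {AP} → Form AP → ℕ
size (pos p)  = 1
size (neg p)  = 1
size (φ ∧ ψ)  = suc (size φ + size ψ)
size (φ ∨ ψ)  = suc (size φ + size ψ)
size (X φ)    = suc (size φ)
size (G φ)    = suc (size φ)
size (φ U ψ)  = suc (size φ + size ψ)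
size (φ ∨B ψ) = suc (size φ + size ψ)

countB : ∀ {AP} → Form AP → ℕ
countB (pos p)  = 0
countB (neg p)  = 0
countB (φ ∧ ψ)  = countB φ + countB ψ
countB (φ ∨ ψ)  = countB φ + countB ψ
countB (X φ)    = countB φ
countB (G φ)    = countB φ
countB (φ U ψ)  = countB φ + countB ψ
countB (φ ∨B ψ) = suc (countB φ + countB ψ)

Trace : Set → Set
Trace AP = ℕ → AP → Bool

Team : Set → Set₁
Team AP = Trace AP × ℕ → Set

-- Set-valued time assignments f : T → P(ℕ); values are offsets from i.
TimeFun : Set → Set₁
TimeFun AP = Trace AP × ℕ → ℕ → Set

NonEmptyOn : ∀ {AP} → Team AP → TimeFun AP → Set
NonEmptyOn T f = ∀ x → T x → ∃ λ n → f x n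

_[_] : ∀ {AP} → Team AP → TimeFun AP → Team AP
(T [ f ]) (t , j) = Σ ℕ λ i → Σ ℕ λ n → T (t , i) × f (t , i) n × (j ≡ i + n)

next : ∀ {AP} → Team AP → Team AP
next T (t , j) = Σ ℕ λ i → T (t , i) × (j ≡ suc i)

-- f' < f : on T (f' may take empty values), every time point chosen by f' lies strictly before
-- some time point chosen by f.
_<[_]_ : ∀ {AP} → TimeFun AP → Team AP → TimeFun AP → Set
f′ <[ T ] f = ∀ x → T x → ∀ m → f′ x m → ∃ λ n → f x n × m < n

_≐_∪_ : ∀ {AP} → Team AP → Team AP → Team AP → Set
T ≐ T₁ ∪ T₂ = ∀ x → (T x → T₁ x ⊎ T₂ x) × (T₁ x ⊎ T₂ x → T x)

-- Lax set-based asynchronous team semantics ⊨ˡ.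
infix 4 _⊨_
_⊨_ : ∀ {AP} → Team AP → Form AP → Set₁
T ⊨ pos p  = Level.Lift (lsuc 0ℓ) (∀ t i → T (t , i) → t i p ≡ true)
T ⊨ neg p  = Level.Lift (lsuc 0ℓ) (∀ t i → T (t , i) → t i p ≡ false)
T ⊨ φ ∧ ψ  = (T ⊨ φ) × (T ⊨ ψ)
T ⊨ φ ∨ ψ  = Σ (Team _) λ T₁ → Σ (Team _) λ T₂ →
               Level.Lift (lsuc 0ℓ) (T ≐ T₁ ∪ T₂) × (T₁ ⊨ φ) × (T₂ ⊨ ψ)
T ⊨ X φ    = next T ⊨ φ
T ⊨ G φ    = ∀ (f : TimeFun _) → NonEmptyOn T f → T [ f ] ⊨ φ
T ⊨ φ U ψ  = Σ (TimeFun _) λ f → Level.Lift (lsuc 0ℓ) (NonEmptyOn T f) × (T [ f ] ⊨ ψ) ×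
               (∀ (f′ : TimeFun _) → f′ <[ T ] f → T [ f′ ] ⊨ φ)
T ⊨ φ ∨B ψ = (T ⊨ φ) ⊎ (T ⊨ ψ)

_⊨⋁B_ : ∀ {AP n} → Team AP → Vec (Form AP) n → Set₁
T ⊨⋁B αs = ∃ λ i → T ⊨ lookup αs i

{-# OPTIONS --safe #-}
-- Lax team semantics is downward closed, so the universal quantifications inside G and U are
-- each decided by one largest instance: T[f] for f choosing every time point, and T[f′] for f′
-- choosing every point strictly before a point chosen by f. Consequently every connective
-- commutes with Boolean disjunction: from φ ≡ ⋁ᵢ αᵢ and ψ ≡ ⋁ⱼ βⱼ we get φ U ψ ≡ ⋁ᵢⱼ αᵢ U βⱼ,
-- G φ ≡ ⋁ᵢ G αᵢ, and likewise for ∧, ∨, X. Pulling all ∨B outwards chooses one side of each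
-- ∨B, so the disjuncts are LTL formulae no larger than φ. The natural index sets (products for
-- binary connectives, sums for ∨B) are covered by Fin (2 ^ k) via surjections, so disjuncts may
-- repeat.
module Submission where

open import Defs
open import Level using (lift)
open import Data.Nat using (suc; _+_; _^_; _<_; _≤_; s≤s)
open import Data.Nat.Properties
  using (^-distribˡ-+-*; +-identityʳ; m^n>0; +-mono-≤; ≤-refl; ≤-trans; m≤m+n; m≤n+m; m≤n⇒m≤1+n)
open import Data.Fin using (Fin; zero; fromℕ<)
open import Data.Fin.Properties using (*↔×; +↔⊎)
open import Data.Product as Product using (Σ; _×_; _,_; proj₁; proj₂; ∃; uncurry′)
open import Data.Sum as Sum using (_⊎_; inj₁; inj₂; [_,_]′)
open import Data.Sum.Function.Propositional using (_⊎-↠_)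
open import Data.Unit using (⊤; tt)
open import Data.Vec using (Vec; lookup; tabulate)
open import Data.Vec.Properties using (lookup∘tabulate)
open import Function using (_∘_; id)
open import Function.Bundles using (_⇔_; mk⇔; Equivalence; _↠_; mk↠ₛ; Surjection)
open import Function.Construct.Composition using (_↠-∘_)
open import Function.Properties.Inverse using (↔⇒↠)
open import Relation.Binary.PropositionalEquality using (_≡_; refl; sym; cong; subst)
open import Relation.Unary using (_⊆′_; _∩_)

open Equivalence using (to; from)

proj₁-↠ : ∀ {A B : Set} → B → (A × B) ↠ A
proj₁-↠ b = mk↠ₛ {to = proj₁} λ a → (a , b) , refl

proj₂-↠ : ∀ {A B : Set} → A → (A × B) ↠ B
proj₂-↠ a = mk↠ₛ {to = proj₂} λ b → (a , b) , refl

2^[m+n]↠× : ∀ m n → Fin (2 ^ (m + n)) ↠ (Fin (2 ^ m) × Fin (2 ^ n))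
2^[m+n]↠× m n =
  subst (λ k → Fin k ↠ (Fin (2 ^ m) × Fin (2 ^ n))) (sym (^-distribˡ-+-* 2 m n)) (↔⇒↠ *↔×)

2^[1+n]↠⊎ : ∀ n → Fin (2 ^ suc n) ↠ (Fin (2 ^ n) ⊎ Fin (2 ^ n))
2^[1+n]↠⊎ n =
  subst (λ k → Fin k ↠ (Fin (2 ^ n) ⊎ Fin (2 ^ n)))
        (cong (2 ^ n +_) (sym (+-identityʳ (2 ^ n))))
        (↔⇒↠ +↔⊎)

2^[1+m+n]↠⊎ : ∀ m n → Fin (2 ^ suc (m + n)) ↠ (Fin (2 ^ m) ⊎ Fin (2 ^ n))
2^[1+m+n]↠⊎ m n =
  ((proj₁-↠ (fromℕ< (m^n>0 2 n)) ↠-∘ 2^[m+n]↠× m n) ⊎-↠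
   (proj₂-↠ (fromℕ< (m^n>0 2 m)) ↠-∘ 2^[m+n]↠× m n))
    ↠-∘ 2^[1+n]↠⊎ (m + n)

module _ {AP : Set} where

  private variable
    I J : Set
    S T T₁ T₂ : Team AP
    f g : TimeFun AP

  ∩-≐-∪ : S ⊆′ T → T ≐ T₁ ∪ T₂ → S ≐ (S ∩ T₁) ∪ (S ∩ T₂)
  ∩-≐-∪ S⊆T T≐T₁∪T₂ x =
    (λ s → Sum.map (s ,_) (s ,_) (proj₁ (T≐T₁∪T₂ x) (S⊆T x s))) , [ proj₁ , proj₁ ]′

  next-mono : S ⊆′ T → next S ⊆′ next T
  next-mono S⊆T (t , _) (i , s , e) = i , S⊆T (t , i) s , e

  []-mono : S ⊆′ T → (∀ x → S x → f x ⊆′ g x) → S [ f ] ⊆′ T [ g ]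
  []-mono S⊆T f⊆g (t , _) (i , n , s , fn , e) = i , n , S⊆T (t , i) s , f⊆g (t , i) s n fn , e

  everywhere : TimeFun AP
  everywhere _ _ = ⊤

  everywhere-nonEmpty : NonEmptyOn T everywhere
  everywhere-nonEmpty _ _ = 0 , tt

  []-⊆-everywhere : S ⊆′ T → S [ f ] ⊆′ T [ everywhere ]
  []-⊆-everywhere S⊆T = []-mono S⊆T λ _ _ _ _ → tt

  before : TimeFun AP → TimeFun AP
  before f x m = ∃ λ n → f x n × m < n

  before-< : before f <[ T ] f
  before-< _ _ _ = id

  <-⊆-before : S ⊆′ T → f <[ S ] g → S [ f ] ⊆′ T [ before g ]
  <-⊆-before = []-mono

  ⊨-downward-closed : ∀ φ → S ⊆′ T → T ⊨ φ → S ⊨ φ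
  ⊨-downward-closed (pos p) S⊆T (lift T⊨p) = lift λ t i s → T⊨p t i (S⊆T (t , i) s)
  ⊨-downward-closed (neg p) S⊆T (lift T⊨¬p) = lift λ t i s → T⊨¬p t i (S⊆T (t , i) s)
  ⊨-downward-closed (φ ∧ ψ) S⊆T (T⊨φ , T⊨ψ) =
    ⊨-downward-closed φ S⊆T T⊨φ , ⊨-downward-closed ψ S⊆T T⊨ψ
  ⊨-downward-closed {S = S} (φ ∨ ψ) S⊆T (T₁ , T₂ , lift T≐T₁∪T₂ , T₁⊨φ , T₂⊨ψ) =
    S ∩ T₁ , S ∩ T₂ , lift (∩-≐-∪ S⊆T T≐T₁∪T₂) ,
    ⊨-downward-closed φ (λ _ → proj₂) T₁⊨φ , ⊨-downward-closed ψ (λ _ → proj₂) T₂⊨ψ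
  ⊨-downward-closed (X φ) S⊆T T⊨Xφ = ⊨-downward-closed φ (next-mono S⊆T) T⊨Xφ
  ⊨-downward-closed (G φ) S⊆T T⊨Gφ f _ =
    ⊨-downward-closed φ ([]-⊆-everywhere S⊆T) (T⊨Gφ everywhere everywhere-nonEmpty)
  ⊨-downward-closed (φ U ψ) S⊆T (f , lift nonEmpty , T[f]⊨ψ , T[<f]⊨φ) =
    f , lift (λ x s → nonEmpty x (S⊆T x s)) ,
    ⊨-downward-closed ψ ([]-mono S⊆T λ _ _ _ → id) T[f]⊨ψ ,
    λ f′ f′<f → ⊨-downward-closed φ (<-⊆-before S⊆T f′<f) (T[<f]⊨φ (before f) before-<)
  ⊨-downward-closed (φ ∨B ψ) S⊆T =
    Sum.map (⊨-downward-closed φ S⊆T) (⊨-downward-closed ψ S⊆T)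

  infix 4 _≈⋁_
  record _≈⋁_ (φ : Form AP) (α : I → Form AP) : Set₁ where
    constructor mk≈⋁
    field teamwise : ∀ T → (T ⊨ φ) ⇔ (∃ λ i → T ⊨ α i)
  open _≈⋁_ public

  private variable
    φ ψ : Form AP
    α β : I → Form AP

  ≈⋁-const : I → φ ≈⋁ (λ (_ : I) → φ)
  ≈⋁-const i = mk≈⋁ λ T → mk⇔ (i ,_) proj₂

  ≈⋁-cong : (∀ i → α i ≡ β i) → φ ≈⋁ α → φ ≈⋁ β
  ≈⋁-cong α≡β φ≈α = mk≈⋁ λ T → mk⇔
    (λ T⊨φ → let (i , T⊨αi) = to (teamwise φ≈α T) T⊨φ in i , subst (T ⊨_) (α≡β i) T⊨αi)
    (λ (i , T⊨βi) → from (teamwise φ≈α T) (i , subst (T ⊨_) (sym (α≡β i)) T⊨βi))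

  ≈⋁-reindex : (s : J ↠ I) → φ ≈⋁ α → φ ≈⋁ (α ∘ Surjection.to s)
  ≈⋁-reindex {α = α} s φ≈α = mk≈⋁ λ T → mk⇔
    (λ T⊨φ → let (i , T⊨αi) = to (teamwise φ≈α T) T⊨φ
                 (j , sj≡i) = Surjection.strictlySurjective s i
             in j , subst (λ k → T ⊨ α k) (sym sj≡i) T⊨αi)
    (λ (j , T⊨αsj) → from (teamwise φ≈α T) (_ , T⊨αsj))

  ≈⋁-∧ : φ ≈⋁ α → ψ ≈⋁ β → φ ∧ ψ ≈⋁ uncurry′ (λ i j → α i ∧ β j)
  ≈⋁-∧ φ≈α ψ≈β = mk≈⋁ λ T → mk⇔
    (λ (T⊨φ , T⊨ψ) → let (i , T⊨αi) = to (teamwise φ≈α T) T⊨φ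
                         (j , T⊨βj) = to (teamwise ψ≈β T) T⊨ψ
                     in (i , j) , T⊨αi , T⊨βj)
    (λ ((i , j) , T⊨αi , T⊨βj) →
       from (teamwise φ≈α T) (i , T⊨αi) , from (teamwise ψ≈β T) (j , T⊨βj))

  ≈⋁-∨ : φ ≈⋁ α → ψ ≈⋁ β → φ ∨ ψ ≈⋁ uncurry′ (λ i j → α i ∨ β j)
  ≈⋁-∨ φ≈α ψ≈β = mk≈⋁ λ T → mk⇔
    (λ (T₁ , T₂ , split , T₁⊨φ , T₂⊨ψ) →
       let (i , T₁⊨αi) = to (teamwise φ≈α T₁) T₁⊨φ
           (j , T₂⊨βj) = to (teamwise ψ≈β T₂) T₂⊨ψ
       in (i , j) , T₁ , T₂ , split , T₁⊨αi , T₂⊨βj)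
    (λ ((i , j) , T₁ , T₂ , split , T₁⊨αi , T₂⊨βj) →
       T₁ , T₂ , split , from (teamwise φ≈α T₁) (i , T₁⊨αi) , from (teamwise ψ≈β T₂) (j , T₂⊨βj))

  ≈⋁-X : φ ≈⋁ α → X φ ≈⋁ (X ∘ α)
  ≈⋁-X φ≈α = mk≈⋁ λ T → teamwise φ≈α (next T)

  ≈⋁-G : φ ≈⋁ α → G φ ≈⋁ (G ∘ α)
  ≈⋁-G {α = α} φ≈α = mk≈⋁ λ T → mk⇔
    (λ T⊨Gφ →
       let (i , T[all]⊨αi) = to (teamwise φ≈α _) (T⊨Gφ everywhere everywhere-nonEmpty)
       in i , λ f _ → ⊨-downward-closed (α i) ([]-⊆-everywhere (λ _ → id)) T[all]⊨αi)
    (λ (i , T⊨Gαi) f nonEmpty → from (teamwise φ≈α _) (i , T⊨Gαi f nonEmpty))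

  ≈⋁-U : φ ≈⋁ α → ψ ≈⋁ β → φ U ψ ≈⋁ uncurry′ (λ i j → α i U β j)
  ≈⋁-U {α = α} φ≈α ψ≈β = mk≈⋁ λ T → mk⇔
    (λ (f , nonEmpty , T[f]⊨ψ , T[<f]⊨φ) →
       let (j , T[f]⊨βj) = to (teamwise ψ≈β _) T[f]⊨ψ
           (i , T[before]⊨αi) = to (teamwise φ≈α _) (T[<f]⊨φ (before f) before-<)
       in (i , j) , f , nonEmpty , T[f]⊨βj ,
          λ f′ f′<f → ⊨-downward-closed (α i) (<-⊆-before (λ _ → id) f′<f) T[before]⊨αi)
    (λ ((i , j) , f , nonEmpty , T[f]⊨βj , T[<f]⊨αi) →
       f , nonEmpty , from (teamwise ψ≈β _) (j , T[f]⊨βj) ,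
       λ f′ f′<f → from (teamwise φ≈α _) (i , T[<f]⊨αi f′ f′<f))

  ≈⋁-∨B : φ ≈⋁ α → ψ ≈⋁ β → φ ∨B ψ ≈⋁ [ α , β ]′
  ≈⋁-∨B φ≈α ψ≈β = mk≈⋁ λ T → mk⇔
    [ Product.map inj₁ id ∘ to (teamwise φ≈α T) , Product.map inj₂ id ∘ to (teamwise ψ≈β T) ]′
    λ { (inj₁ i , T⊨αi) → inj₁ (from (teamwise φ≈α T) (i , T⊨αi))
      ; (inj₂ j , T⊨βj) → inj₂ (from (teamwise ψ≈β T) (j , T⊨βj)) }

  splitIndex : (φ ψ : Form AP) →
    Fin (2 ^ (countB φ + countB ψ)) → Fin (2 ^ countB φ) × Fin (2 ^ countB ψ)
  splitIndex φ ψ = Surjection.to (2^[m+n]↠× (countB φ) (countB ψ))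

  chooseIndex : (φ ψ : Form AP) →
    Fin (2 ^ suc (countB φ + countB ψ)) → Fin (2 ^ countB φ) ⊎ Fin (2 ^ countB ψ)
  chooseIndex φ ψ = Surjection.to (2^[1+m+n]↠⊎ (countB φ) (countB ψ))

  dnf : (φ : Form AP) → Fin (2 ^ countB φ) → Form AP
  dnf (pos p)  _ = pos p
  dnf (neg p)  _ = neg p
  dnf (φ ∧ ψ)    = uncurry′ (λ i j → dnf φ i ∧ dnf ψ j) ∘ splitIndex φ ψ
  dnf (φ ∨ ψ)    = uncurry′ (λ i j → dnf φ i ∨ dnf ψ j) ∘ splitIndex φ ψ
  dnf (X φ)      = X ∘ dnf φ
  dnf (G φ)      = G ∘ dnf φ
  dnf (φ U ψ)    = uncurry′ (λ i j → dnf φ i U dnf ψ j) ∘ splitIndex φ ψ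
  dnf (φ ∨B ψ)   = [ dnf φ , dnf ψ ]′ ∘ chooseIndex φ ψ

  dnf-isLTL : ∀ φ k → IsLTL (dnf φ k)
  dnf-isLTL (pos p) _ = pos p
  dnf-isLTL (neg p) _ = neg p
  dnf-isLTL (φ ∧ ψ) k = let (i , j) = splitIndex φ ψ k in dnf-isLTL φ i ∧ dnf-isLTL ψ j
  dnf-isLTL (φ ∨ ψ) k = let (i , j) = splitIndex φ ψ k in dnf-isLTL φ i ∨ dnf-isLTL ψ j
  dnf-isLTL (X φ)   k = X (dnf-isLTL φ k)
  dnf-isLTL (G φ)   k = G (dnf-isLTL φ k)
  dnf-isLTL (φ U ψ) k = let (i , j) = splitIndex φ ψ k in dnf-isLTL φ i U dnf-isLTL ψ j
  dnf-isLTL (φ ∨B ψ) k with chooseIndex φ ψ k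
  ... | inj₁ i = dnf-isLTL φ i
  ... | inj₂ j = dnf-isLTL ψ j

  dnf-size : ∀ φ k → size (dnf φ k) ≤ size φ
  dnf-size (pos p) _ = ≤-refl
  dnf-size (neg p) _ = ≤-refl
  dnf-size (φ ∧ ψ) k = let (i , j) = splitIndex φ ψ k in s≤s (+-mono-≤ (dnf-size φ i) (dnf-size ψ j))
  dnf-size (φ ∨ ψ) k = let (i , j) = splitIndex φ ψ k in s≤s (+-mono-≤ (dnf-size φ i) (dnf-size ψ j))
  dnf-size (X φ)   k = s≤s (dnf-size φ k)
  dnf-size (G φ)   k = s≤s (dnf-size φ k)
  dnf-size (φ U ψ) k = let (i , j) = splitIndex φ ψ k in s≤s (+-mono-≤ (dnf-size φ i) (dnf-size ψ j))
  dnf-size (φ ∨B ψ) k with chooseIndex φ ψ k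
  ... | inj₁ i = ≤-trans (dnf-size φ i) (m≤n⇒m≤1+n (m≤m+n (size φ) (size ψ)))
  ... | inj₂ j = ≤-trans (dnf-size ψ j) (m≤n⇒m≤1+n (m≤n+m (size ψ) (size φ)))

  dnf-≈⋁ : ∀ φ → φ ≈⋁ dnf φ
  dnf-≈⋁ (pos p)  = ≈⋁-const zero
  dnf-≈⋁ (neg p)  = ≈⋁-const zero
  dnf-≈⋁ (φ ∧ ψ)  = ≈⋁-reindex (2^[m+n]↠× (countB φ) (countB ψ)) (≈⋁-∧ (dnf-≈⋁ φ) (dnf-≈⋁ ψ))
  dnf-≈⋁ (φ ∨ ψ)  = ≈⋁-reindex (2^[m+n]↠× (countB φ) (countB ψ)) (≈⋁-∨ (dnf-≈⋁ φ) (dnf-≈⋁ ψ))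
  dnf-≈⋁ (X φ)    = ≈⋁-X (dnf-≈⋁ φ)
  dnf-≈⋁ (G φ)    = ≈⋁-G (dnf-≈⋁ φ)
  dnf-≈⋁ (φ U ψ)  = ≈⋁-reindex (2^[m+n]↠× (countB φ) (countB ψ)) (≈⋁-U (dnf-≈⋁ φ) (dnf-≈⋁ ψ))
  dnf-≈⋁ (φ ∨B ψ) = ≈⋁-reindex (2^[1+m+n]↠⊎ (countB φ) (countB ψ)) (≈⋁-∨B (dnf-≈⋁ φ) (dnf-≈⋁ ψ))

theorem10 : ∀ {AP : Set} (φ : Form AP) →
    Σ (Vec (Form AP) (2 ^ countB φ)) λ αs →
      (∀ (i : Fin (2 ^ countB φ)) → IsLTL (lookup αs i) × size (lookup αs i) ≤ size φ)
      × (∀ (T : Team AP) → (T ⊨ φ) ⇔ (T ⊨⋁B αs))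
theorem10 φ = tabulate (dnf φ) , bounds , teamwise (≈⋁-cong (sym ∘ lookup-dnf) (dnf-≈⋁ φ))
  where
  lookup-dnf : ∀ i → lookup (tabulate (dnf φ)) i ≡ dnf φ i
  lookup-dnf = lookup∘tabulate (dnf φ)

  bounds : ∀ i → IsLTL (lookup (tabulate (dnf φ)) i) × size (lookup (tabulate (dnf φ)) i) ≤ size φ
  bounds i rewrite lookup-dnf i = dnf-isLTL φ i , dnf-size φ i
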